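{- Let $p_1,p_2$ be distinct primes with $p_1\equiv p_2\equiv 3\pmod 4$, let $f\in\{1,2\}$ and $\Delta=p_1p_2f^2$. Then every $\mathrm{GL}_2(\mathbb{Z})$-equivalence class of quadratic irrationals of discriminant $\Delta$ contains a reduced quadratic irrational $\frac{b+\sqrt{\Delta}}{2a}$ with $a>0$ and $\gcd(a,p_1)=1$.
   Context: A quadratic irrational of discriminant $\Delta$ is a number $\xi=\frac{b+\sqrt\Delta}{2a}$ with $a\ne0$, $b,c\in\mathbb{Z}$, $\gcd(a,b,c)=1$, $b^2-4ac=\Delta$. $\mathrm{GL}_2(\mathbb{Z})$ acts by $\begin{pmatrix}\alpha&\beta\\\gamma&\delta\end{pmatrix}\xi=\frac{\alpha\xi+\beta}{\gamma\xi+\delta}$, and two such irrationals are equivalent if one is sent to the other by some element of $\mathrm{GL}_2(\mathbb{Z})$. $\xi$ is reduced if $\xi>1$ and $-1<\xi'<0$, where $\xi'$ is the conjugate of $\xi$. -}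

module Defs where

open import Data.Integer using (ℤ; +_; _+_; _-_; _*_; -_; _<_; _≤_; 0ℤ; 1ℤ; -1ℤ)
open import Data.Integer.GCD using (gcd)
open import Data.Product using (_×_; _,_; ∃; ∃-syntax)
open import Data.Sum using (_⊎_)
open import Relation.Binary.PropositionalEquality using (_≡_; _≢_)

-- Elements x + y√Δ of ℤ[√Δ], as pairs (x , y) of integers.
-- For the Δ considered (Δ > 0 not a perfect square) √Δ is irrational, so
-- x + y√Δ = x' + y'√Δ  iff  (x , y) ≡ (x' , y').

ℤ√ : Set
ℤ√ = ℤ × ℤ

_⊕_ : ℤ√ → ℤ√ → ℤ√
(x , y) ⊕ (x' , y') = (x + x' , y + y')

_·_ : ℤ → ℤ√ → ℤ√
k · (x , y) = (k * x , k * y)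

mul : ℤ → ℤ√ → ℤ√ → ℤ√
mul Δ (x , y) (x' , y') = (x * x' + Δ * (y * y') , x * y' + x' * y)

-- Pos Δ (x , y) : the real number x + y√Δ is > 0  (Δ ≥ 0), written out
-- by cases on the signs of x and y.
Pos : ℤ → ℤ√ → Set
Pos Δ (x , y) =
    (0ℤ ≤ x × 0ℤ < y)
  ⊎ (0ℤ < x × 0ℤ ≤ y)
  ⊎ (0ℤ ≤ x × y < 0ℤ × Δ * (y * y) < x * x)
  ⊎ (x < 0ℤ × 0ℤ < y × x * x < Δ * (y * y))

-- Quadratic irrationals ξ = (b + √Δ)/(2a) of discriminant Δ:
-- a ≠ 0, b, c ∈ ℤ, gcd(a,b,c) = 1, b² - 4ac = Δ.
-- (For nonsquare Δ the pair (a , b) is uniquely determined by ξ, so this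
-- record is a faithful representation of the number ξ.)

record QI (Δ : ℤ) : Set where
  constructor qi
  field
    a b c : ℤ
    a≢0   : a ≢ 0ℤ
    prim  : gcd (gcd a b) c ≡ 1ℤ
    disc  : b * b - (+ 4) * a * c ≡ Δ

open QI public

num : ∀ {Δ} → QI Δ → ℤ√
num ξ = (b ξ , 1ℤ)

den : ∀ {Δ} → QI Δ → ℤ
den ξ = (+ 2) * a ξ

-- M = (α β ; γ δ) with αδ - βγ = ±1 sends ξ to η iff
--   (αξ + β)/(γξ + δ) = η,  i.e. (cross-multiplying; γξ+δ ≠ 0 as ξ is
--   irrational and (γ,δ) ≠ (0,0))  αξ + β = η (γξ + δ).
-- Multiplying by (2a)(2a') with ξ = N/(2a), η = N'/(2a'):
--   2a' (α N + 2a β) = N' (γ N + 2a δ)   in ℤ[√Δ].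

Acts : (Δ α β γ δ : ℤ) → QI Δ → QI Δ → Set
Acts Δ α β γ δ ξ η =
  den η · ((α · num ξ) ⊕ ((den ξ * β) , 0ℤ))
    ≡ mul Δ (num η) ((γ · num ξ) ⊕ ((den ξ * δ) , 0ℤ))

Equiv : (Δ : ℤ) → QI Δ → QI Δ → Set
Equiv Δ ξ η = ∃[ α ] ∃[ β ] ∃[ γ ] ∃[ δ ]
  ((α * δ - β * γ ≡ 1ℤ ⊎ α * δ - β * γ ≡ -1ℤ) × Acts Δ α β γ δ ξ η)

-- Reduced: ξ > 1 and -1 < ξ' < 0, with ξ' = (b - √Δ)/(2a).
-- Each inequality is multiplied by 2a² > 0:
--   ξ > 1    ⟺  a(b - 2a) + a√Δ > 0
--   ξ' < 0   ⟺  -ab + a√Δ > 0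
--   ξ' > -1  ⟺  a(b + 2a) - a√Δ > 0

Reduced : (Δ : ℤ) → QI Δ → Set
Reduced Δ ξ =
    Pos Δ (a ξ * (b ξ - (+ 2) * a ξ) , a ξ)
  × Pos Δ (- (a ξ * b ξ) , a ξ)
  × Pos Δ (a ξ * (b ξ + (+ 2) * a ξ) , - a ξ)

-- To ξ = (b + √Δ)/2a attach the binary quadratic form (a, b, c). Matrices act on forms compatibly with their
-- action on the irrationals, preserving discriminant and primitivity. As Δ = p₁p₂f² > 0 is not a square, no
-- form of discriminant Δ vanishes at an integer point (x, 1), and Gauss's descent (center b in [-a, a], swap
-- a and c while |c| < |a|) reaches a form with a > 0 > c and 4a² < Δ. Translating to the integer m where
-- F(x, 1) changes sign gives a reduced form: a > 0 > c, F(1, 1) > 0 > F(-1, 1). If p₁ ∣ a then p₁ ∣ b, so by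
-- primitivity p₁ ∤ c, and one more move ξ ↦ 1/(ξ - m), m chosen at the sign change of F(-x, 1), yields a
-- reduced form whose leading coefficient -F(-m, 1) is prime to p₁. The congruences only serve to make Δ a
-- non-square (p₁ ≢ 2 excludes p₁ ∣ f).
module Submission where

open import Data.Nat using (ℕ; zero; suc; _%_)
import Data.Nat as ℕ
import Data.Nat.Properties as ℕ
import Data.Nat.Divisibility as ℕ
import Data.Nat.GCD as ℕ
import Data.Nat.Tactic.RingSolver as ℕ
open import Data.Nat.Primality using (Prime; prime⇒nonZero; euclidsLemma; prime⇒irreducible; irreducible[2]; ¬prime[1])
open import Data.Integer
  using (ℤ; +_; -[1+_]; 0ℤ; 1ℤ; -1ℤ; _+_; _-_; _*_; -_; ∣_∣; _<_; _≤_; +<+; +≤+; -<+; nonNegative; positive; >-nonZero; _≤?_)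
open import Data.Integer.Properties
open import Data.Integer.DivMod using (a≡a%n+[a/n]*n; n%d<d) renaming (_/_ to _div_; _%_ to _mod_)
open import Data.Integer.Tactic.RingSolver using (solve-∀)
open import Data.Integer.Divisibility.Signed
  using (_∣_; _∣?_; ∣ᵤ⇒∣; ∣⇒∣ᵤ; ∣m∣n⇒∣m+n; ∣m∣n⇒∣m-n; ∣m⇒∣-m; ∣m⇒∣m*n; ∣n⇒∣m*n)
open import Data.Integer.Divisibility using () renaming (_∣_ to _∣ᵤ_)
open import Data.Integer.GCD using (gcd; gcd[i,j]∣i; gcd[i,j]∣j; gcd-greatest)
open import Data.Product using (Σ; ∃-syntax; _×_; _,_; proj₁; proj₂)
open import Function using (case_of_)
open import Data.Sum using (_⊎_; inj₁; inj₂)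
open import Data.Empty using (⊥-elim)
open import Relation.Nullary using (¬_; Dec; yes; no)
open import Relation.Binary.Definitions using (tri<; tri≈; tri>)
open import Relation.Binary.PropositionalEquality
open import Defs

private
  *-nonNeg : ∀ {i j} → 0ℤ ≤ i → 0ℤ ≤ j → 0ℤ ≤ i * j
  *-nonNeg {i} i≥0 j≥0 = subst (_≤ i * _) (*-zeroʳ i) (*-monoˡ-≤-nonNeg i {{nonNegative i≥0}} j≥0)

  *-pos : ∀ {i j} → 0ℤ < i → 0ℤ < j → 0ℤ < i * j
  *-pos {i} i>0 j>0 = subst (_< i * _) (*-zeroʳ i) (*-monoˡ-<-pos i {{positive i>0}} j>0)

  *-pos-neg : ∀ {i j} → 0ℤ < i → j < 0ℤ → i * j < 0ℤ
  *-pos-neg {i} i>0 j<0 = subst (i * _ <_) (*-zeroʳ i) (*-monoˡ-<-pos i {{positive i>0}} j<0)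

  *-cancel-pos : ∀ {k i} → 0ℤ < k → 0ℤ < k * i → 0ℤ < i
  *-cancel-pos {k} k>0 ki>0 =
    *-cancelˡ-<-nonNeg k {{nonNegative (<⇒≤ k>0)}} (subst (_< k * _) (sym (*-zeroʳ k)) ki>0)

  i<j⇒0<j-i : ∀ {i j} → i < j → 0ℤ < j - i
  i<j⇒0<j-i {i} {j} i<j = subst (_< j - i) (+-inverseʳ i) (+-monoˡ-< (- i) i<j)

  0<j-i⇒i<j : ∀ {i j} → 0ℤ < j - i → i < j
  0<j-i⇒i<j {i} {j} j-i>0 = subst₂ _<_ (+-identityˡ i) (lemma i j) (+-monoˡ-< i j-i>0)
    where lemma : ∀ i j → j - i + i ≡ j
          lemma = solve-∀

  square-nonNeg : ∀ i → 0ℤ ≤ i * i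
  square-nonNeg (+ n) = *-nonNeg {+ n} {+ n} (+≤+ ℕ.z≤n) (+≤+ ℕ.z≤n)
  square-nonNeg -[1+ n ] = +≤+ ℕ.z≤n

  square-mono-< : ∀ {i j} → 0ℤ ≤ i → i < j → i * i < j * j
  square-mono-< {i} {j} i≥0 i<j = 0<j-i⇒i<j (subst (0ℤ <_) (lemma i j) (*-pos (i<j⇒0<j-i i<j) j+i>0))
    where lemma : ∀ i j → (j - i) * (j + i) ≡ j * j - i * i
          lemma = solve-∀
          j+i>0 : 0ℤ < j + i
          j+i>0 = +-mono-<-≤ (≤-<-trans i≥0 i<j) i≥0

  i+∣i∣≥0 : ∀ i → 0ℤ ≤ i + + ∣ i ∣
  i+∣i∣≥0 (+ n) = +≤+ ℕ.z≤n
  i+∣i∣≥0 -[1+ n ] = ≤-reflexive (sym (trans (+-comm -[1+ n ] (+ suc n)) (+-inverseʳ (+ suc n))))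

  difference-neg : ∀ {k v y z} → 0ℤ < k → k * v ≡ y - z → v < 0ℤ → y < z
  difference-neg {k} {v} {y} {z} k>0 kv≡y-z v<0 =
    subst₂ _<_ (lemma y z) (+-identityˡ z) (+-monoˡ-< z (subst (_< 0ℤ) kv≡y-z (*-pos-neg k>0 v<0)))
    where lemma : ∀ y z → y - z + z ≡ y
          lemma = solve-∀

  difference-pos : ∀ {k v y z} → 0ℤ < k → k * v ≡ y - z → 0ℤ < v → z < y
  difference-pos k>0 kv≡y-z v>0 = 0<j-i⇒i<j (subst (0ℤ <_) kv≡y-z (*-pos k>0 v>0))

  scaled-square-< : ∀ {z x y u} → 0ℤ < y * y → x * x ≡ y * y * (u * u) → u * u < z → x * x < z * (y * y)
  scaled-square-< {z} {y = y} y²>0 x²≡y²u² u²<z =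
    subst₂ _<_ (sym x²≡y²u²) (*-comm (y * y) z) (*-monoˡ-<-pos (y * y) {{positive y²>0}} u²<z)

  scaled-square-> : ∀ {z x y u} → 0ℤ < y * y → x * x ≡ y * y * (u * u) → z < u * u → z * (y * y) < x * x
  scaled-square-> {z} {y = y} y²>0 x²≡y²u² z<u² =
    subst₂ _<_ (*-comm (y * y) z) (sym x²≡y²u²) (*-monoˡ-<-pos (y * y) {{positive y²>0}} z<u²)

prime∣square⇒prime∣ : ∀ {p} n → Prime p → p ℕ.∣ n ℕ.* n → p ℕ.∣ n
prime∣square⇒prime∣ n p-prime p∣n² with euclidsLemma n n p-prime p∣n²
... | inj₁ p∣n = p∣n
... | inj₂ p∣n = p∣n

prime∣square⇒prime∣ᵢ : ∀ {p} i → Prime p → + p ∣ i * i → + p ∣ i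
prime∣square⇒prime∣ᵢ i p-prime p∣i² =
  ∣ᵤ⇒∣ (prime∣square⇒prime∣ ∣ i ∣ p-prime (subst (_ ℕ.∣_) (abs-* i i) (∣⇒∣ᵤ p∣i²)))

prime*nonMultiple-nonsquare : ∀ {p r} → Prime p → ¬ (p ℕ.∣ r) → ∀ n → n ℕ.* n ≢ p ℕ.* r
prime*nonMultiple-nonsquare {p} {r} p-prime p∤r n n²≡pr
  with prime∣square⇒prime∣ n p-prime (ℕ.divides r (trans n²≡pr (ℕ.*-comm p r)))
... | ℕ.divides k refl = p∤r (ℕ.divides (k ℕ.* k) (ℕ.*-cancelˡ-≡ r (k ℕ.* k ℕ.* p) p pr≡pk²p))
  where
    instance _ = prime⇒nonZero p-prime
    sq : ∀ k p → k ℕ.* p ℕ.* (k ℕ.* p) ≡ p ℕ.* (k ℕ.* k ℕ.* p)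
    sq = ℕ.solve-∀
    pr≡pk²p : p ℕ.* r ≡ p ℕ.* (k ℕ.* k ℕ.* p)
    pr≡pk²p = trans (sym n²≡pr) (sq k p)

≡3[mod4]⇒∤2 : ∀ {p} → p % 4 ≡ 3 → ¬ (p ℕ.∣ 2)
≡3[mod4]⇒∤2 p≡3 p∣2 with irreducible[2] p∣2 | p≡3
... | inj₁ refl | ()
... | inj₂ refl | ()

1or2∣2 : ∀ {f} → f ≡ 1 ⊎ f ≡ 2 → f ℕ.∣ 2
1or2∣2 (inj₁ refl) = ℕ.1∣ 2
1or2∣2 (inj₂ refl) = ℕ.∣-refl

p₁p₂f²-nonsquare : ∀ {p₁ p₂ f} → Prime p₁ → Prime p₂ → p₁ ≢ p₂ → p₁ % 4 ≡ 3 → f ≡ 1 ⊎ f ≡ 2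
  → ∀ n → n ℕ.* n ≢ p₁ ℕ.* p₂ ℕ.* (f ℕ.* f)
p₁p₂f²-nonsquare {p₁} {p₂} {f} p₁-prime p₂-prime p₁≢p₂ p₁≡3 f∈12 n n²≡Δ =
  prime*nonMultiple-nonsquare p₁-prime p₁∤p₂f² n (trans n²≡Δ (ℕ.*-assoc p₁ p₂ (f ℕ.* f)))
  where
    p₁∤p₂ : ¬ (p₁ ℕ.∣ p₂)
    p₁∤p₂ p₁∣p₂ with prime⇒irreducible p₂-prime p₁∣p₂
    ... | inj₁ refl = ≡3[mod4]⇒∤2 p₁≡3 (ℕ.1∣ 2)
    ... | inj₂ p₁≡p₂ = p₁≢p₂ p₁≡p₂
    p₁∤p₂f² : ¬ (p₁ ℕ.∣ p₂ ℕ.* (f ℕ.* f))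
    p₁∤p₂f² p₁∣p₂f² with euclidsLemma p₂ (f ℕ.* f) p₁-prime p₁∣p₂f²
    ... | inj₁ p₁∣p₂ = p₁∤p₂ p₁∣p₂
    ... | inj₂ p₁∣f² = ≡3[mod4]⇒∤2 p₁≡3 (ℕ.∣-trans (prime∣square⇒prime∣ f p₁-prime p₁∣f²) (1or2∣2 f∈12))

nonsquare⇒nonsquareℤ : ∀ {N} → (∀ n → n ℕ.* n ≢ N) → ∀ t → t * t ≢ + N
nonsquare⇒nonsquareℤ nonsquare t t²≡N = nonsquare ∣ t ∣ (trans (sym (abs-* t t)) (cong ∣_∣ t²≡N))

nonsquare⇒pos : ∀ {N} → (∀ n → n ℕ.* n ≢ N) → 0ℤ < + N
nonsquare⇒pos {zero} nonsquare = ⊥-elim (nonsquare 0 refl)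
nonsquare⇒pos {suc N} nonsquare = +<+ (ℕ.s≤s ℕ.z≤n)

record Form : Set where
  constructor ⟨_,_,_⟩
  field fa fb fc : ℤ
open Form

fdisc : Form → ℤ
fdisc ⟨ a , b , c ⟩ = b * b - (+ 4) * a * c

_⟦_⟧ : Form → ℤ × ℤ → ℤ
⟨ a , b , c ⟩ ⟦ x , y ⟧ = a * x * x + b * x * y + c * y * y

cong₃ : ∀ {A B C D : Set} (f : A → B → C → D) {x x′ y y′ z z′}
  → x ≡ x′ → y ≡ y′ → z ≡ z′ → f x y z ≡ f x′ y′ z′
cong₃ f refl refl refl = refl

-- A form is determined by its values at (1,0), (0,1) and (1,1).
form-ext : ∀ {F G} → (∀ v → F ⟦ v ⟧ ≡ G ⟦ v ⟧) → F ≡ G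
form-ext {⟨ a , b , c ⟩} {⟨ a′ , b′ , c′ ⟩} F≗G = cong₃ ⟨_,_,_⟩
  (trans (sym (value-10 a b c)) (trans (F≗G (1ℤ , 0ℤ)) (value-10 a′ b′ c′)))
  (trans (sym (polar-11 a b c)) (trans (cong₃ (λ u v w → u - v - w) (F≗G (1ℤ , 1ℤ)) (F≗G (1ℤ , 0ℤ)) (F≗G (0ℤ , 1ℤ))) (polar-11 a′ b′ c′)))
  (trans (sym (value-01 a b c)) (trans (F≗G (0ℤ , 1ℤ)) (value-01 a′ b′ c′)))
  where
    value-10 : ∀ a b c → a * 1ℤ * 1ℤ + b * 1ℤ * 0ℤ + c * 0ℤ * 0ℤ ≡ a
    value-10 = solve-∀
    value-01 : ∀ a b c → a * 0ℤ * 0ℤ + b * 0ℤ * 1ℤ + c * 1ℤ * 1ℤ ≡ c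
    value-01 = solve-∀
    polar-11 : ∀ a b c → let F = λ x y → a * x * x + b * x * y + c * y * y
                         in F 1ℤ 1ℤ - F 1ℤ 0ℤ - F 0ℤ 1ℤ ≡ b
    polar-11 = solve-∀

record Matrix : Set where
  constructor mat
  field α β γ δ : ℤ

det : Matrix → ℤ
det (mat α β γ δ) = α * δ - β * γ

_·ₘ_ : Matrix → Matrix → Matrix
mat α β γ δ ·ₘ mat α′ β′ γ′ δ′ =
  mat (α * α′ + β * γ′) (α * β′ + β * δ′) (γ * α′ + δ * γ′) (γ * β′ + δ * δ′)

_⊙_ : Matrix → ℤ × ℤ → ℤ × ℤ
mat α β γ δ ⊙ (x , y) = (δ * x + β * y , γ * x + α * y)

-- The form of M ξ when F is the form of ξ = (b + √Δ)/2a (see ∼⇒Equiv); without the factor det M, matrices of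
-- determinant -1 would yield the form of the conjugate of M ξ.
act : Matrix → Form → Form
act M@(mat α β γ δ) F =
  ⟨ det M * F ⟦ δ , γ ⟧
  , det M * (F ⟦ δ + β , γ + α ⟧ - F ⟦ δ , γ ⟧ - F ⟦ β , α ⟧)
  , det M * F ⟦ β , α ⟧ ⟩

act-eval : ∀ M F v → act M F ⟦ v ⟧ ≡ det M * F ⟦ M ⊙ v ⟧
act-eval (mat α β γ δ) ⟨ a , b , c ⟩ (x , y) = identity α β γ δ a b c x y
  where
    identity : ∀ α β γ δ a b c x y →
      let e = α * δ - β * γ
          F = λ u v → a * u * u + b * u * v + c * v * v
      in e * F δ γ * x * x + e * (F (δ + β) (γ + α) - F δ γ - F β α) * x * y + e * F β α * y * y
         ≡ e * F (δ * x + β * y) (γ * x + α * y)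
    identity = solve-∀

⊙-·ₘ : ∀ G M v → (G ·ₘ M) ⊙ v ≡ M ⊙ (G ⊙ v)
⊙-·ₘ (mat α β γ δ) (mat α′ β′ γ′ δ′) (x , y) = cong₂ _,_ (first α β γ δ α′ β′ γ′ δ′ x y) (second α β γ δ α′ β′ γ′ δ′ x y)
  where
    first : ∀ α β γ δ α′ β′ γ′ δ′ x y →
      (γ * β′ + δ * δ′) * x + (α * β′ + β * δ′) * y ≡ δ′ * (δ * x + β * y) + β′ * (γ * x + α * y)
    first = solve-∀
    second : ∀ α β γ δ α′ β′ γ′ δ′ x y →
      (γ * α′ + δ * γ′) * x + (α * α′ + β * γ′) * y ≡ γ′ * (δ * x + β * y) + α′ * (γ * x + α * y)
    second = solve-∀

det-·ₘ : ∀ G M → det (G ·ₘ M) ≡ det G * det M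
det-·ₘ (mat α β γ δ) (mat α′ β′ γ′ δ′) = identity α β γ δ α′ β′ γ′ δ′
  where
    identity : ∀ α β γ δ α′ β′ γ′ δ′ →
      (α * α′ + β * γ′) * (γ * β′ + δ * δ′) - (α * β′ + β * δ′) * (γ * α′ + δ * γ′)
        ≡ (α * δ - β * γ) * (α′ * δ′ - β′ * γ′)
    identity = solve-∀

act-·ₘ : ∀ G M F → act G (act M F) ≡ act (G ·ₘ M) F
act-·ₘ G M F = form-ext λ v → begin
  act G (act M F) ⟦ v ⟧                ≡⟨ act-eval G (act M F) v ⟩
  det G * act M F ⟦ G ⊙ v ⟧            ≡⟨ cong (det G *_) (act-eval M F (G ⊙ v)) ⟩
  det G * (det M * F ⟦ M ⊙ (G ⊙ v) ⟧)  ≡⟨ sym (*-assoc (det G) (det M) _) ⟩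
  det G * det M * F ⟦ M ⊙ (G ⊙ v) ⟧    ≡⟨ cong₂ (λ e w → e * F ⟦ w ⟧) (sym (det-·ₘ G M)) (sym (⊙-·ₘ G M v)) ⟩
  det (G ·ₘ M) * F ⟦ (G ·ₘ M) ⊙ v ⟧    ≡⟨ sym (act-eval (G ·ₘ M) F v) ⟩
  act (G ·ₘ M) F ⟦ v ⟧                 ∎
  where open ≡-Reasoning

I : Matrix
I = mat 1ℤ 0ℤ 0ℤ 1ℤ

act-I : ∀ F → act I F ≡ F
act-I F@(⟨ a , b , c ⟩) = form-ext λ v → trans (act-eval I F v) (identity a b c (proj₁ v) (proj₂ v))
  where
    identity : ∀ a b c x y → let F = λ u v → a * u * u + b * u * v + c * v * v
      in (1ℤ * 1ℤ - 0ℤ * 0ℤ) * F (1ℤ * x + 0ℤ * y) (0ℤ * x + 1ℤ * y) ≡ F x y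
    identity = solve-∀

fdisc-act : ∀ M F → fdisc (act M F) ≡ det M * det M * (det M * det M) * fdisc F
fdisc-act (mat α β γ δ) ⟨ a , b , c ⟩ = identity α β γ δ a b c
  where
    identity : ∀ α β γ δ a b c →
      let e = α * δ - β * γ
          F = λ u v → a * u * u + b * u * v + c * v * v
          b′ = e * (F (δ + β) (γ + α) - F δ γ - F β α)
      in b′ * b′ - (+ 4) * (e * F δ γ) * (e * F β α) ≡ e * e * (e * e) * (b * b - (+ 4) * a * c)
    identity = solve-∀

_∣ᶠ_ : ℤ → Form → Set
d ∣ᶠ ⟨ a , b , c ⟩ = (d ∣ a) × (d ∣ b) × (d ∣ c)

Primitive : Form → Set
Primitive F = ∀ {d} → d ∣ᶠ F → d ∣ 1ℤ

∣ᶠ⇒∣value : ∀ {d} F v → d ∣ᶠ F → d ∣ F ⟦ v ⟧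
∣ᶠ⇒∣value ⟨ a , b , c ⟩ (x , y) (d∣a , d∣b , d∣c) =
  ∣m∣n⇒∣m+n (∣m∣n⇒∣m+n (∣x⇒∣x*y*z d∣a) (∣x⇒∣x*y*z d∣b)) (∣x⇒∣x*y*z d∣c)
  where
    ∣x⇒∣x*y*z : ∀ {d x y z} → d ∣ x → d ∣ x * y * z
    ∣x⇒∣x*y*z {y = y} {z} d∣x = ∣m⇒∣m*n z (∣m⇒∣m*n y d∣x)

∣ᶠ-act : ∀ {d} M F → d ∣ᶠ F → d ∣ᶠ act M F
∣ᶠ-act M@(mat α β γ δ) F d∣F =
    ∣n⇒∣m*n (det M) (value (δ , γ))
  , ∣n⇒∣m*n (det M) (∣m∣n⇒∣m-n (∣m∣n⇒∣m-n (value (δ + β , γ + α)) (value (δ , γ))) (value (β , α)))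
  , ∣n⇒∣m*n (det M) (value (β , α))
  where value = λ v → ∣ᶠ⇒∣value F v d∣F

IsUnit : ℤ → Set
IsUnit e = e ≡ 1ℤ ⊎ e ≡ -1ℤ

unit-* : ∀ {e e′} → IsUnit e → IsUnit e′ → IsUnit (e * e′)
unit-* (inj₁ refl) (inj₁ refl) = inj₁ refl
unit-* (inj₁ refl) (inj₂ refl) = inj₂ refl
unit-* (inj₂ refl) (inj₁ refl) = inj₂ refl
unit-* (inj₂ refl) (inj₂ refl) = inj₁ refl

unit-square : ∀ {e} → IsUnit e → e * e ≡ 1ℤ
unit-square (inj₁ refl) = refl
unit-square (inj₂ refl) = refl

infix 4 _∼_

-- The inverse matrix is recorded so that primitivity transfers back without inverting matrices.
record _∼_ (F G : Form) : Set where
  field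
    matrix inverse : Matrix
    unimodular : IsUnit (det matrix)
    image : G ≡ act matrix F
    preimage : F ≡ act inverse G

∼-refl : ∀ {F} → F ∼ F
∼-refl {F} = record
  { matrix = I ; inverse = I ; unimodular = inj₁ refl
  ; image = sym (act-I F) ; preimage = sym (act-I F) }

∼-trans : ∀ {F G H} → F ∼ G → G ∼ H → F ∼ H
∼-trans {F} {G} {H} F∼G G∼H = record
  { matrix = N.matrix ·ₘ M.matrix
  ; inverse = M.inverse ·ₘ N.inverse
  ; unimodular = subst IsUnit (sym (det-·ₘ N.matrix M.matrix)) (unit-* N.unimodular M.unimodular)
  ; image = trans N.image (trans (cong (act N.matrix) M.image) (act-·ₘ N.matrix M.matrix F))
  ; preimage = trans M.preimage (trans (cong (act M.inverse) N.preimage) (act-·ₘ M.inverse N.inverse H))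
  }
  where
    module M = _∼_ F∼G
    module N = _∼_ G∼H

∼-fdisc : ∀ {F G} → F ∼ G → fdisc G ≡ fdisc F
∼-fdisc {F} {G} F∼G = begin
  fdisc G                        ≡⟨ cong fdisc image ⟩
  fdisc (act matrix F)           ≡⟨ fdisc-act matrix F ⟩
  e * e * (e * e) * fdisc F      ≡⟨ cong (λ u → u * u * fdisc F) (unit-square unimodular) ⟩
  1ℤ * 1ℤ * fdisc F              ≡⟨ *-identityˡ (fdisc F) ⟩
  fdisc F                        ∎
  where
    open _∼_ F∼G
    open ≡-Reasoning
    e = det matrix

∼-primitive : ∀ {F G} → F ∼ G → Primitive F → Primitive G
∼-primitive {F} F∼G F-primitive {d} d∣G =
  F-primitive (subst (d ∣ᶠ_) (sym preimage) (∣ᶠ-act inverse _ d∣G))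
  where open _∼_ F∼G

Representative : (Form → Set) → Form → Set
Representative P F = Σ Form λ G → F ∼ G × P G

∼-representative : ∀ {P F G} → F ∼ G → Representative P G → Representative P F
∼-representative F∼G (H , G∼H , P-H) = H , ∼-trans F∼G G∼H , P-H

translate : ℤ → Form → Form
translate k F@(⟨ a , b , c ⟩) = ⟨ a , b + (+ 2) * a * k , F ⟦ k , 1ℤ ⟧ ⟩

swap : Form → Form
swap ⟨ a , b , c ⟩ = ⟨ c , - b , a ⟩

negate : Form → Form
negate ⟨ a , b , c ⟩ = ⟨ - a , b , - c ⟩

translate-act : ∀ k F → translate k F ≡ act (mat 1ℤ k 0ℤ 1ℤ) F
translate-act k F@(⟨ a , b , c ⟩) = form-ext λ v →
  trans (identity k a b c (proj₁ v) (proj₂ v)) (sym (act-eval (mat 1ℤ k 0ℤ 1ℤ) F v))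
  where
    identity : ∀ k a b c x y → let F = λ u v → a * u * u + b * u * v + c * v * v
      in a * x * x + (b + (+ 2) * a * k) * x * y + F k 1ℤ * y * y
         ≡ (1ℤ * 1ℤ - k * 0ℤ) * F (1ℤ * x + k * y) (0ℤ * x + 1ℤ * y)
    identity = solve-∀

swap-act : ∀ F → swap F ≡ act (mat 0ℤ -1ℤ 1ℤ 0ℤ) F
swap-act F@(⟨ a , b , c ⟩) = form-ext λ v →
  trans (identity a b c (proj₁ v) (proj₂ v)) (sym (act-eval (mat 0ℤ -1ℤ 1ℤ 0ℤ) F v))
  where
    identity : ∀ a b c x y → let F = λ u v → a * u * u + b * u * v + c * v * v
      in c * x * x + (- b) * x * y + a * y * y ≡ (0ℤ * 0ℤ - -1ℤ * 1ℤ) * F (0ℤ * x + -1ℤ * y) (1ℤ * x + 0ℤ * y)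
    identity = solve-∀

negate-act : ∀ F → negate F ≡ act (mat -1ℤ 0ℤ 0ℤ 1ℤ) F
negate-act F@(⟨ a , b , c ⟩) = form-ext λ v →
  trans (identity a b c (proj₁ v) (proj₂ v)) (sym (act-eval (mat -1ℤ 0ℤ 0ℤ 1ℤ) F v))
  where
    identity : ∀ a b c x y → let F = λ u v → a * u * u + b * u * v + c * v * v
      in (- a) * x * x + b * x * y + (- c) * y * y ≡ (-1ℤ * 1ℤ - 0ℤ * 0ℤ) * F (1ℤ * x + 0ℤ * y) (0ℤ * x + -1ℤ * y)
    identity = solve-∀

translate-translate : ∀ k F → translate (- k) (translate k F) ≡ F
translate-translate k ⟨ a , b , c ⟩ = cong₃ ⟨_,_,_⟩ refl (middle k a b) (last k a b c)
  where
    middle : ∀ k a b → b + (+ 2) * a * k + (+ 2) * a * (- k) ≡ b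
    middle = solve-∀
    last : ∀ k a b c →
      a * (- k) * (- k) + (b + (+ 2) * a * k) * (- k) * 1ℤ + (a * k * k + b * k * 1ℤ + c * 1ℤ * 1ℤ) * 1ℤ * 1ℤ ≡ c
    last = solve-∀

swap-swap : ∀ F → swap (swap F) ≡ F
swap-swap ⟨ a , b , c ⟩ = cong (λ b′ → ⟨ a , b′ , c ⟩) (neg-involutive b)

negate-negate : ∀ F → negate (negate F) ≡ F
negate-negate ⟨ a , b , c ⟩ = cong₂ (λ a′ c′ → ⟨ a′ , b , c′ ⟩) (neg-involutive a) (neg-involutive c)

∼-translate : ∀ k F → F ∼ translate k F
∼-translate k F = record
  { matrix = mat 1ℤ k 0ℤ 1ℤ ; inverse = mat 1ℤ (- k) 0ℤ 1ℤ
  ; unimodular = inj₁ (cong (λ t → 1ℤ - t) (*-zeroʳ k))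
  ; image = translate-act k F
  ; preimage = trans (sym (translate-translate k F)) (translate-act (- k) (translate k F)) }

∼-swap : ∀ F → F ∼ swap F
∼-swap F = record
  { matrix = mat 0ℤ -1ℤ 1ℤ 0ℤ ; inverse = mat 0ℤ -1ℤ 1ℤ 0ℤ ; unimodular = inj₁ refl
  ; image = swap-act F
  ; preimage = trans (sym (swap-swap F)) (swap-act (swap F)) }

∼-negate : ∀ F → F ∼ negate F
∼-negate F = record
  { matrix = mat -1ℤ 0ℤ 0ℤ 1ℤ ; inverse = mat -1ℤ 0ℤ 0ℤ 1ℤ ; unimodular = inj₂ refl
  ; image = negate-act F
  ; preimage = trans (sym (negate-negate F)) (negate-act (negate F)) }

formOf : ∀ {Δ} → QI Δ → Form
formOf ξ = ⟨ a ξ , b ξ , c ξ ⟩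

gcd≡1⇒primitive : ∀ {a b c} → gcd (gcd a b) c ≡ 1ℤ → Primitive ⟨ a , b , c ⟩
gcd≡1⇒primitive {a} {b} {c} gcd≡1 {d} (d∣a , d∣b , d∣c) = ∣ᵤ⇒∣ (subst (d ∣ᵤ_) gcd≡1
  (gcd-greatest {gcd a b} {c} {d} (gcd-greatest {a} {b} {d} (∣⇒∣ᵤ d∣a) (∣⇒∣ᵤ d∣b)) (∣⇒∣ᵤ d∣c)))

primitive⇒gcd≡1 : ∀ {a b c} → Primitive ⟨ a , b , c ⟩ → gcd (gcd a b) c ≡ 1ℤ
primitive⇒gcd≡1 {a} {b} {c} F-primitive = cong +_ (ℕ.∣1⇒≡1 (∣⇒∣ᵤ (F-primitive (g∣a , g∣b , g∣c))))
  where
    g = gcd (gcd a b) c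
    g∣a = ∣ᵤ⇒∣ {g} (ℕ.∣-trans (gcd[i,j]∣i (gcd a b) c) (gcd[i,j]∣i a b))
    g∣b = ∣ᵤ⇒∣ {g} (ℕ.∣-trans (gcd[i,j]∣i (gcd a b) c) (gcd[i,j]∣j a b))
    g∣c = ∣ᵤ⇒∣ {g} (gcd[i,j]∣j (gcd a b) c)

-- Cross-multiplied form of  M ξ = η  for ξ = (b + √Δ)/2a and η = (B + √Δ)/2A with (A , B , _) = act M (a , b , c),
-- compared coefficientwise in ℤ[√Δ].
act-root-equation : ∀ {Δ} α β γ δ a b c {A B} → b * b - (+ 4) * a * c ≡ Δ
  → let e = α * δ - β * γ
        F = λ u v → a * u * u + b * u * v + c * v * v
    in e * e ≡ 1ℤ → A ≡ e * F δ γ → B ≡ e * (F (δ + β) (γ + α) - F δ γ - F β α)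
  → ((+ 2) * A * (α * b + (+ 2) * a * β) , (+ 2) * A * (α * 1ℤ + 0ℤ))
    ≡ (B * (γ * b + (+ 2) * a * δ) + Δ * (1ℤ * (γ * 1ℤ + 0ℤ)) , B * (γ * 1ℤ + 0ℤ) + (γ * b + (+ 2) * a * δ) * 1ℤ)
act-root-equation α β γ δ a b c refl e²≡1 refl refl = cong₂ _,_
  (trans (rational-part e α β γ δ a b c) (absorb (e * P * v) ((b * b - (+ 4) * a * c) * (1ℤ * γ′)) e²≡1))
  (trans (irrational-part e α β γ δ a b c) (absorb (e * P * γ′) (v * 1ℤ) e²≡1))
  where
    e = α * δ - β * γ
    F = λ u v → a * u * u + b * u * v + c * v * v
    P = F (δ + β) (γ + α) - F δ γ - F β α
    v = γ * b + (+ 2) * a * δ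
    γ′ = γ * 1ℤ + 0ℤ
    absorb : ∀ X Y {E} → E ≡ 1ℤ → X + E * Y ≡ X + Y
    absorb X Y refl = cong (λ t → X + t) (*-identityˡ Y)
    rational-part : ∀ e α β γ δ a b c →
      let F = λ u v → a * u * u + b * u * v + c * v * v
      in (+ 2) * (e * F δ γ) * (α * b + (+ 2) * a * β)
         ≡ e * (F (δ + β) (γ + α) - F δ γ - F β α) * (γ * b + (+ 2) * a * δ)
           + e * (α * δ - β * γ) * ((b * b - (+ 4) * a * c) * (1ℤ * (γ * 1ℤ + 0ℤ)))
    rational-part = solve-∀
    irrational-part : ∀ e α β γ δ a b c →
      let F = λ u v → a * u * u + b * u * v + c * v * v
      in (+ 2) * (e * F δ γ) * (α * 1ℤ + 0ℤ)
         ≡ e * (F (δ + β) (γ + α) - F δ γ - F β α) * (γ * 1ℤ + 0ℤ)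
           + e * (α * δ - β * γ) * ((γ * b + (+ 2) * a * δ) * 1ℤ)
    irrational-part = solve-∀

∼⇒Equiv : ∀ {Δ} (ξ η : QI Δ) → formOf ξ ∼ formOf η → Equiv Δ ξ η
∼⇒Equiv ξ η ξ∼η with _∼_.matrix ξ∼η | _∼_.unimodular ξ∼η | _∼_.image ξ∼η
... | mat α β γ δ | unit | image =
  α , β , γ , δ , unit ,
  act-root-equation α β γ δ (a ξ) (b ξ) (c ξ) (disc ξ) (unit-square unit) (cong fa image) (cong fb image)

SignChangeFrom : (ℤ → ℤ) → ℤ → Set
SignChangeFrom h s = Σ ℤ λ m → h m < 0ℤ × 0ℤ < h (m + 1ℤ) × (m ≡ s ⊎ h (m - 1ℤ) < 0ℤ)

sign-change : ∀ (h : ℤ → ℤ) → (∀ x → h x ≢ 0ℤ) → ∀ N s → h s < 0ℤ → 0ℤ < h (s + + N) → SignChangeFrom h s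
sign-change h h≢0 zero s hs<0 0<hs+0 = ⊥-elim (<-asym hs<0 (subst (λ t → 0ℤ < h t) (+-identityʳ s) 0<hs+0))
sign-change h h≢0 (suc N) s hs<0 0<hs+N+1 with <-cmp (h (s + 1ℤ)) 0ℤ
... | tri> _ _ 0<hs+1 = s , hs<0 , 0<hs+1 , inj₁ refl
... | tri≈ _ hs+1≡0 _ = ⊥-elim (h≢0 (s + 1ℤ) hs+1≡0)
... | tri< hs+1<0 _ _ with sign-change h h≢0 N (s + 1ℤ) hs+1<0 (subst (λ t → 0ℤ < h t) s+[N+1]≡s+1+N 0<hs+N+1)
  where
    s+[N+1]≡s+1+N : s + + suc N ≡ s + 1ℤ + + N
    s+[N+1]≡s+1+N = trans (cong (λ t → s + t) (pos-+ 1 N)) (sym (+-assoc s 1ℤ (+ N)))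
...   | m , hm<0 , 0<hm+1 , inj₂ hm-1<0 = m , hm<0 , 0<hm+1 , inj₂ hm-1<0
...   | m , hm<0 , 0<hm+1 , inj₁ refl = m , hm<0 , 0<hm+1 , inj₂ (subst (λ t → h t < 0ℤ) (sym (s+1-1≡s s)) hs<0)
  where
    s+1-1≡s : ∀ s → s + 1ℤ - 1ℤ ≡ s
    s+1-1≡s = solve-∀

value-positive-far : ∀ a b c → 0ℤ < a → 0ℤ < ⟨ a , b , c ⟩ ⟦ + ∣ b ∣ + + ∣ c ∣ + 1ℤ , 1ℤ ⟧
value-positive-far a b c a>0 =
  suc[i]≤j⇒i<j (0≤i-j⇒j≤i (subst (0ℤ ≤_) (sym (identity a b c B C)) (+-mono-≤ (+-mono-≤ (+-mono-≤ (+-mono-≤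
    (*-nonNeg (i≤j⇒0≤j-i (i<j⇒suc[i]≤j a>0)) (*-nonNeg x≥0 x≥0))
    (*-nonNeg (i+∣i∣≥0 b) x≥0)) (*-nonNeg {C} (+≤+ ℕ.z≤n) B+C≥0)) (i+∣i∣≥0 c)) B+C≥0)))
  where
    B = + ∣ b ∣
    C = + ∣ c ∣
    x≥0 : 0ℤ ≤ B + C + 1ℤ
    x≥0 = +≤+ ℕ.z≤n
    B+C≥0 : 0ℤ ≤ B + C
    B+C≥0 = +≤+ ℕ.z≤n
    identity : ∀ a b c B C → let x = B + C + 1ℤ
      in a * x * x + b * x * 1ℤ + c * 1ℤ * 1ℤ - 1ℤ
         ≡ (a - 1ℤ) * (x * x) + (b + B) * x + C * (B + C) + (c + C) + (B + C)
    identity = solve-∀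

completing-square : ∀ a b c x →
  (+ 4) * a * ⟨ a , b , c ⟩ ⟦ x , 1ℤ ⟧ ≡ ((+ 2) * a * x + b) * ((+ 2) * a * x + b) - fdisc ⟨ a , b , c ⟩
completing-square a b c x = identity a b c x
  where
    identity : ∀ a b c x → (+ 4) * a * (a * x * x + b * x * 1ℤ + c * 1ℤ * 1ℤ)
      ≡ ((+ 2) * a * x + b) * ((+ 2) * a * x + b) - (b * b - (+ 4) * a * c)
    identity = solve-∀

F[0]≡c : ∀ a b c → ⟨ a , b , c ⟩ ⟦ 0ℤ , 1ℤ ⟧ ≡ c
F[0]≡c a b c = identity a b c
  where identity : ∀ a b c → a * 0ℤ * 0ℤ + b * 0ℤ * 1ℤ + c * 1ℤ * 1ℤ ≡ c
        identity = solve-∀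

mirror-disc : ∀ a b c → fdisc ⟨ a , - b , c ⟩ ≡ fdisc ⟨ a , b , c ⟩
mirror-disc a b c = identity a b c
  where identity : ∀ a b c → - b * - b - (+ 4) * a * c ≡ b * b - (+ 4) * a * c
        identity = solve-∀

-- a + b + c = F(1,1) and a - b + c = F(-1,1): these conditions say ξ > 1 and -1 < ξ' < 0.
ReducedForm : Form → Set
ReducedForm ⟨ a , b , c ⟩ = 0ℤ < a × c < 0ℤ × 0ℤ < a + b + c × a - b + c < 0ℤ

reduced-bounds : ∀ {a b c} → ReducedForm ⟨ a , b , c ⟩
  → 0ℤ < b × b * b < fdisc ⟨ a , b , c ⟩
  × (b - (+ 2) * a) * (b - (+ 2) * a) < fdisc ⟨ a , b , c ⟩
  × fdisc ⟨ a , b , c ⟩ < (b + (+ 2) * a) * (b + (+ 2) * a)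
reduced-bounds {a} {b} {c} (a>0 , c<0 , a+b+c>0 , a-b+c<0) =
    *-cancel-pos {+ 2} (+<+ (ℕ.s≤s ℕ.z≤n)) (subst (0ℤ <_) (2b a b c) (i<j⇒0<j-i (<-trans a-b+c<0 a+b+c>0)))
  , difference-neg 4a>0 (4ac a b c) c<0
  , difference-neg 4a>0 (4aF[-1] a b c) a-b+c<0
  , difference-pos 4a>0 (4aF[1] a b c) a+b+c>0
  where
    4a>0 : 0ℤ < (+ 4) * a
    4a>0 = *-pos {+ 4} (+<+ (ℕ.s≤s ℕ.z≤n)) a>0
    2b : ∀ a b c → a + b + c - (a - b + c) ≡ (+ 2) * b
    2b = solve-∀
    4ac : ∀ a b c → (+ 4) * a * c ≡ b * b - (b * b - (+ 4) * a * c)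
    4ac = solve-∀
    4aF[-1] : ∀ a b c → (+ 4) * a * (a - b + c) ≡ (b - (+ 2) * a) * (b - (+ 2) * a) - (b * b - (+ 4) * a * c)
    4aF[-1] = solve-∀
    4aF[1] : ∀ a b c → (+ 4) * a * (a + b + c) ≡ (b + (+ 2) * a) * (b + (+ 2) * a) - (b * b - (+ 4) * a * c)
    4aF[1] = solve-∀

ξ>1 : ∀ {Δ a b} → 0ℤ < a → (b - (+ 2) * a) * (b - (+ 2) * a) < Δ → Pos Δ (a * (b - (+ 2) * a) , a)
ξ>1 {a = a} {b} a>0 [b-2a]²<Δ with 0ℤ ≤? b - (+ 2) * a
... | yes b-2a≥0 = inj₁ (*-nonNeg (<⇒≤ a>0) b-2a≥0 , a>0)
... | no b-2a≱0 = inj₂ (inj₂ (inj₂ (*-pos-neg a>0 (≰⇒> b-2a≱0) , a>0 ,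
  scaled-square-< {x = a * (b - (+ 2) * a)} {a} {b - (+ 2) * a} (*-pos a>0 a>0) (identity a b) [b-2a]²<Δ)))
  where identity : ∀ a b → a * (b - (+ 2) * a) * (a * (b - (+ 2) * a)) ≡ a * a * ((b - (+ 2) * a) * (b - (+ 2) * a))
        identity = solve-∀

ξ′<0 : ∀ {Δ a b} → 0ℤ < a → 0ℤ < b → b * b < Δ → Pos Δ (- (a * b) , a)
ξ′<0 {a = a} {b} a>0 b>0 b²<Δ = inj₂ (inj₂ (inj₂ (neg-mono-< (*-pos a>0 b>0) , a>0 ,
  scaled-square-< {x = - (a * b)} {a} {b} (*-pos a>0 a>0) (identity a b) b²<Δ)))
  where identity : ∀ a b → - (a * b) * - (a * b) ≡ a * a * (b * b)
        identity = solve-∀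

ξ′>-1 : ∀ {Δ a b} → 0ℤ < a → 0ℤ < b → Δ < (b + (+ 2) * a) * (b + (+ 2) * a) → Pos Δ (a * (b + (+ 2) * a) , - a)
ξ′>-1 {a = a} {b} a>0 b>0 Δ<[b+2a]² = inj₂ (inj₂ (inj₁ (*-nonNeg (<⇒≤ a>0) (<⇒≤ b+2a>0) , neg-mono-< a>0 ,
  scaled-square-> {x = a * (b + (+ 2) * a)} { - a} {b + (+ 2) * a} (subst (0ℤ <_) (sym (identity₁ a)) (*-pos a>0 a>0))
    (identity₂ a b) Δ<[b+2a]²)))
  where
    b+2a>0 : 0ℤ < b + (+ 2) * a
    b+2a>0 = +-mono-< b>0 (*-pos {+ 2} (+<+ (ℕ.s≤s ℕ.z≤n)) a>0)
    identity₁ : ∀ a → - a * - a ≡ a * a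
    identity₁ = solve-∀
    identity₂ : ∀ a b → a * (b + (+ 2) * a) * (a * (b + (+ 2) * a)) ≡ - a * - a * ((b + (+ 2) * a) * (b + (+ 2) * a))
    identity₂ = solve-∀

reducedForm⇒Reduced : ∀ {Δ} (η : QI Δ) → ReducedForm (formOf η) → Reduced Δ η
reducedForm⇒Reduced (qi a b c _ _ refl) F-reduced@(a>0 , _) with reduced-bounds F-reduced
... | b>0 , b²<Δ , [b-2a]²<Δ , Δ<[b+2a]² = ξ>1 {b = b} a>0 [b-2a]²<Δ , ξ′<0 a>0 b>0 b²<Δ , ξ′>-1 a>0 b>0 Δ<[b+2a]²

center : ∀ a b → 0ℤ < a → Σ ℤ λ k → - a ≤ b + (+ 2) * a * k × b + (+ 2) * a * k ≤ a
center a b a>0 = choose (r ≤? a)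
  where
    2a>0 : 0ℤ < (+ 2) * a
    2a>0 = *-pos {+ 2} (+<+ (ℕ.s≤s ℕ.z≤n)) a>0
    instance _ = >-nonZero 2a>0
    r = + (b mod ((+ 2) * a))
    q = b div ((+ 2) * a)
    b≡r+q2a : b ≡ r + q * ((+ 2) * a)
    b≡r+q2a = a≡a%n+[a/n]*n b ((+ 2) * a)
    r<2a : r < (+ 2) * a
    r<2a = subst (r <_) (0≤i⇒+∣i∣≡i (<⇒≤ 2a>0)) (+<+ (n%d<d b ((+ 2) * a)))
    choose : Dec (r ≤ a) → Σ ℤ λ k → - a ≤ b + (+ 2) * a * k × b + (+ 2) * a * k ≤ a
    choose (yes r≤a) = - q , subst (- a ≤_) (sym b-2aq≡r) (≤-trans (neg-mono-≤ (<⇒≤ a>0)) (+≤+ ℕ.z≤n))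
                           , subst (_≤ a) (sym b-2aq≡r) r≤a
      where
        identity : ∀ r q a → r + q * ((+ 2) * a) + (+ 2) * a * (- q) ≡ r
        identity = solve-∀
        b-2aq≡r : b + (+ 2) * a * (- q) ≡ r
        b-2aq≡r = trans (cong (λ b → b + (+ 2) * a * (- q)) b≡r+q2a) (identity r q a)
    choose (no r≰a) = - q - 1ℤ , subst (- a ≤_) (sym b-2a[q+1]≡r-2a) lower , subst (_≤ a) (sym b-2a[q+1]≡r-2a) upper
      where
        identity : ∀ r q a → r + q * ((+ 2) * a) + (+ 2) * a * (- q - 1ℤ) ≡ r - (+ 2) * a
        identity = solve-∀
        b-2a[q+1]≡r-2a : b + (+ 2) * a * (- q - 1ℤ) ≡ r - (+ 2) * a
        b-2a[q+1]≡r-2a = trans (cong (λ b → b + (+ 2) * a * (- q - 1ℤ)) b≡r+q2a) (identity r q a)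
        -a≡a-2a : ∀ a → - a ≡ a - (+ 2) * a
        -a≡a-2a = solve-∀
        lower : - a ≤ r - (+ 2) * a
        lower = subst (_≤ r - (+ 2) * a) (sym (-a≡a-2a a)) (+-monoˡ-≤ (- ((+ 2) * a)) (<⇒≤ (≰⇒> r≰a)))
        upper : r - (+ 2) * a ≤ a
        upper = ≤-trans (i≤j⇒i-j≤0 (<⇒≤ r<2a)) (<⇒≤ a>0)

module _ {Δ : ℤ} (nonsquare : ∀ t → t * t ≢ Δ) (Δ>0 : 0ℤ < Δ) where

  value≢0 : ∀ F x → fdisc F ≡ Δ → F ⟦ x , 1ℤ ⟧ ≢ 0ℤ
  value≢0 F@(⟨ a , b , c ⟩) x disc≡Δ F[x]≡0 = nonsquare y (i-j≡0⇒i≡j (y * y) Δ (begin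
    y * y - Δ                  ≡⟨ cong (λ d → y * y - d) (sym disc≡Δ) ⟩
    y * y - fdisc F            ≡⟨ sym (completing-square a b c x) ⟩
    (+ 4) * a * F ⟦ x , 1ℤ ⟧   ≡⟨ cong ((+ 4) * a *_) F[x]≡0 ⟩
    (+ 4) * a * 0ℤ             ≡⟨ *-zeroʳ ((+ 4) * a) ⟩
    0ℤ                         ∎))
    where
      open ≡-Reasoning
      y = (+ 2) * a * x + b

  -- a > 0 > c and 2a < √Δ: the two roots of F(x,1) are more than 2 apart and on either side of 0.
  Prereduced : Form → Set
  Prereduced ⟨ a , b , c ⟩ = 0ℤ < a × c < 0ℤ × (+ 4) * a * a < Δ

  centered⇒prereduced : ∀ {a b c} → fdisc ⟨ a , b , c ⟩ ≡ Δ → 0ℤ < a → - a ≤ b → b ≤ a → ∣ a ∣ ℕ.≤ ∣ c ∣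
    → Prereduced ⟨ a , b , c ⟩
  centered⇒prereduced {a} {b} {+ n} disc≡Δ a>0 -a≤b b≤a ∣a∣≤n = ⊥-elim (<⇒≱ Δ>0 (neg-cancel-≤ -Δ≥0))
    where
      a≤c : a ≤ + n
      a≤c = subst (_≤ + n) (0≤i⇒+∣i∣≡i (<⇒≤ a>0)) (+≤+ ∣a∣≤n)
      identity : ∀ a b c → (a - b) * (b - - a) + (+ 4) * a * (c - a) + (+ 3) * (a * a) ≡ - (b * b - (+ 4) * a * c)
      identity = solve-∀
      -Δ≥0 : - 0ℤ ≤ - Δ
      -Δ≥0 = subst (λ d → 0ℤ ≤ - d) disc≡Δ (subst (0ℤ ≤_) (identity a b (+ n))
        (+-mono-≤ (+-mono-≤ (*-nonNeg (i≤j⇒0≤j-i b≤a) (i≤j⇒0≤j-i -a≤b)) (*-nonNeg (<⇒≤ (*-pos {+ 4} (+<+ (ℕ.s≤s ℕ.z≤n)) a>0)) (i≤j⇒0≤j-i a≤c)))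
          (*-nonNeg {+ 3} (+≤+ ℕ.z≤n) (square-nonNeg a))))
  centered⇒prereduced {a} {b} {c@(-[1+ n ])} disc≡Δ a>0 -a≤b b≤a ∣a∣≤∣c∣ = a>0 , -<+ , ≤∧≢⇒< 4a²≤Δ 4a²≢Δ
    where
      a≤-c : a ≤ - c
      a≤-c = subst (_≤ - c) (0≤i⇒+∣i∣≡i (<⇒≤ a>0)) (+≤+ ∣a∣≤∣c∣)
      identity : ∀ a b c → b * b - (+ 4) * a * c - (+ 4) * a * a ≡ b * b + (+ 4) * a * (- c - a)
      identity = solve-∀
      4a²≤Δ : (+ 4) * a * a ≤ Δ
      4a²≤Δ = 0≤i-j⇒j≤i (subst (λ d → 0ℤ ≤ d - (+ 4) * a * a) disc≡Δ (subst (0ℤ ≤_) (sym (identity a b c))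
        (+-mono-≤ (square-nonNeg b) (*-nonNeg (<⇒≤ (*-pos {+ 4} (+<+ (ℕ.s≤s ℕ.z≤n)) a>0)) (i≤j⇒0≤j-i a≤-c)))))
      4a²≢Δ : (+ 4) * a * a ≢ Δ
      4a²≢Δ 4a²≡Δ = nonsquare ((+ 2) * a) (trans (identity₂ a) 4a²≡Δ)
        where identity₂ : ∀ a → (+ 2) * a * ((+ 2) * a) ≡ (+ 4) * a * a
              identity₂ = solve-∀

  positive-leading : ∀ F → fa F ≢ 0ℤ → Representative (λ G → 0ℤ < fa G × ∣ fa G ∣ ≡ ∣ fa F ∣) F
  positive-leading F a≢0 with <-cmp (fa F) 0ℤ
  ... | tri< a<0 _ _ = negate F , ∼-negate F , neg-mono-< a<0 , ∣-i∣≡∣i∣ (fa F)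
  ... | tri≈ _ a≡0 _ = ⊥-elim (a≢0 a≡0)
  ... | tri> _ _ a>0 = F , ∼-refl , a>0 , refl

  descent-step : ∀ F → fdisc F ≡ Δ → fa F ≢ 0ℤ
    → Representative Prereduced F ⊎ Representative (λ G → fa G ≢ 0ℤ × ∣ fa G ∣ ℕ.< ∣ fa F ∣) F
  descent-step F disc≡Δ a≢0 =
    let F₁ , F∼F₁ , a₁>0 , ∣a₁∣≡∣a∣ = positive-leading F a≢0
        k , lower , upper = center (fa F₁) (fb F₁) a₁>0
        F₂ = translate k F₁
        F∼F₂ = ∼-trans F∼F₁ (∼-translate k F₁)
    in case ∣ fc F₂ ∣ ℕ.<? ∣ fa F₂ ∣ of λ where
      (no c₂≮a₂) → inj₁ (F₂ , F∼F₂ ,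
        centered⇒prereduced (trans (∼-fdisc F∼F₂) disc≡Δ) a₁>0 lower upper (ℕ.≮⇒≥ c₂≮a₂))
      (yes c₂<a₂) → inj₂ (swap F₂ , ∼-trans F∼F₂ (∼-swap F₂) ,
        value≢0 F₁ k (trans (∼-fdisc F∼F₁) disc≡Δ) , subst (∣ fc F₂ ∣ ℕ.<_) ∣a₁∣≡∣a∣ c₂<a₂)

  descend : ∀ n F → fdisc F ≡ Δ → fa F ≢ 0ℤ → ∣ fa F ∣ ℕ.< n → Representative Prereduced F
  descend zero F _ _ ()
  descend (suc n) F disc≡Δ a≢0 ∣a∣<1+n = continue (descent-step F disc≡Δ a≢0)
    where
      continue : Representative Prereduced F ⊎ Representative (λ G → fa G ≢ 0ℤ × ∣ fa G ∣ ℕ.< ∣ fa F ∣) F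
        → Representative Prereduced F
      continue (inj₁ done) = done
      continue (inj₂ (G , F∼G , aG≢0 , ∣aG∣<∣a∣)) = ∼-representative F∼G
        (descend n G (trans (∼-fdisc F∼G) disc≡Δ) aG≢0 (ℕ.<-≤-trans ∣aG∣<∣a∣ (ℕ.≤-pred ∣a∣<1+n)))

  -- If F(-1,1) ≥ 0 as well, then Δ = (a - c)² - F(1,1) F(-1,1) ≤ (a - c)² < (2a)², as 0 < a + c and c < 0.
  prereduced⇒a-b+c<0 : ∀ {a b c} → fdisc ⟨ a , b , c ⟩ ≡ Δ → Prereduced ⟨ a , b , c ⟩ → 0ℤ < a + b + c
    → a - b + c < 0ℤ
  prereduced⇒a-b+c<0 {a} {b} {c} disc≡Δ (a>0 , c<0 , 4a²<Δ) u>0 = ≰⇒> λ v≥0 → <-asym 4a²<Δ (Δ<4a² v≥0)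
    where
      u = a + b + c
      v = a - b + c
      Δ<4a² : 0ℤ ≤ v → Δ < (+ 4) * a * a
      Δ<4a² v≥0 = begin-strict
        Δ                                  ≤⟨ i≤i+j Δ (u * v) {{nonNegative (*-nonNeg (<⇒≤ u>0) v≥0)}} ⟩
        Δ + u * v                          ≡⟨ cong (_+ u * v) (sym disc≡Δ) ⟩
        b * b - (+ 4) * a * c + u * v      ≡⟨ identity₁ a b c ⟩
        (a - c) * (a - c)                  <⟨ square-mono-< (i≤j⇒0≤j-i (<⇒≤ (<-trans c<0 a>0))) a-c<2a ⟩
        (+ 2) * a * ((+ 2) * a)            ≡⟨ identity₂ a ⟩
        (+ 4) * a * a                      ∎
        where
          open ≤-Reasoning
          identity₁ : ∀ a b c → b * b - (+ 4) * a * c + (a + b + c) * (a - b + c) ≡ (a - c) * (a - c)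
          identity₁ = solve-∀
          identity₂ : ∀ a → (+ 2) * a * ((+ 2) * a) ≡ (+ 4) * a * a
          identity₂ = solve-∀
          a+c>0 : 0ℤ < a + c
          a+c>0 = *-cancel-pos {+ 2} (+<+ (ℕ.s≤s ℕ.z≤n)) (subst (0ℤ <_) (identity₃ a b c) (+-mono-<-≤ u>0 v≥0))
            where identity₃ : ∀ a b c → (a + b + c) + (a - b + c) ≡ (+ 2) * (a + c)
                  identity₃ = solve-∀
          a-c<2a : a - c < (+ 2) * a
          a-c<2a = 0<j-i⇒i<j (subst (0ℤ <_) (identity₄ a c) a+c>0)
            where identity₄ : ∀ a c → a + c ≡ (+ 2) * a - (a - c)
                  identity₄ = solve-∀

  sign-change-of-value : ∀ a b c → fdisc ⟨ a , b , c ⟩ ≡ Δ → 0ℤ < a → c < 0ℤ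
    → SignChangeFrom (λ x → ⟨ a , b , c ⟩ ⟦ x , 1ℤ ⟧) 0ℤ
  sign-change-of-value a b c disc≡Δ a>0 c<0 =
    sign-change (λ x → F ⟦ x , 1ℤ ⟧) (λ x → value≢0 F x disc≡Δ) N 0ℤ
      (subst (_< 0ℤ) (sym (F[0]≡c a b c)) c<0)
      (value-positive-far a b c a>0)
    where
      F = ⟨ a , b , c ⟩
      N = ∣ b ∣ ℕ.+ ∣ c ∣ ℕ.+ 1

  prereduced⇒reduced : ∀ F → fdisc F ≡ Δ → Prereduced F → Representative ReducedForm F
  prereduced⇒reduced F@(⟨ a , b , c ⟩) disc≡Δ (a>0 , c<0 , 4a²<Δ) =
    translate-to-sign-change (sign-change-of-value a b c disc≡Δ a>0 c<0)
    where
      identity : ∀ a b c m → a * (m + 1ℤ) * (m + 1ℤ) + b * (m + 1ℤ) * 1ℤ + c * 1ℤ * 1ℤ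
        ≡ a + (b + (+ 2) * a * m) + (a * m * m + b * m * 1ℤ + c * 1ℤ * 1ℤ)
      identity = solve-∀
      translate-to-sign-change : SignChangeFrom (λ x → F ⟦ x , 1ℤ ⟧) 0ℤ → Representative ReducedForm F
      translate-to-sign-change (m , F[m]<0 , F[m+1]>0 , _) =
        translate m F , ∼-translate m F , a>0 , F[m]<0 , a+b′+c′>0 ,
        prereduced⇒a-b+c<0 (trans (∼-fdisc (∼-translate m F)) disc≡Δ) (a>0 , F[m]<0 , 4a²<Δ) a+b′+c′>0
        where
          a+b′+c′>0 : 0ℤ < a + (b + (+ 2) * a * m) + F ⟦ m , 1ℤ ⟧
          a+b′+c′>0 = subst (0ℤ <_) (identity a b c m) F[m+1]>0

  -- G = negate (swap (translate (- m) F)) is the form of 1/(ξ - m). As p ∣ a and p ∣ Δ force p ∣ b, its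
  -- leading coefficient -F(-m,1) is divisible by p only if c is, which primitivity excludes.
  avoid-prime-leading : ∀ {p} → Prime p → + p ∣ Δ → ∀ F → fdisc F ≡ Δ → Primitive F → ReducedForm F
    → + p ∣ fa F → Representative (λ G → ReducedForm G × ¬ (+ p ∣ fa G)) F
  avoid-prime-leading {p} p-prime p∣Δ F@(⟨ a , b , c ⟩) disc≡Δ F-primitive (a>0 , c<0 , a+b+c>0 , a-b+c<0) p∣a =
    invert-at (sign-change-of-value a (- b) c (trans (mirror-disc a b c) disc≡Δ) a>0 c<0)
    where
      H[1]≡a-b+c : ∀ a b c → a * (0ℤ + 1ℤ) * (0ℤ + 1ℤ) + - b * (0ℤ + 1ℤ) * 1ℤ + c * 1ℤ * 1ℤ ≡ a - b + c
      H[1]≡a-b+c = solve-∀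
      F[-m]≡H[m] : ∀ a b c m → a * - m * - m + b * - m * 1ℤ + c * 1ℤ * 1ℤ ≡ a * m * m + - b * m * 1ℤ + c * 1ℤ * 1ℤ
      F[-m]≡H[m] = solve-∀
      G[1]≡-H[m-1] : ∀ a b c m → - (a * (m - 1ℤ) * (m - 1ℤ) + - b * (m - 1ℤ) * 1ℤ + c * 1ℤ * 1ℤ)
        ≡ - (a * - m * - m + b * - m * 1ℤ + c * 1ℤ * 1ℤ) + - (b + (+ 2) * a * - m) + - a
      G[1]≡-H[m-1] = solve-∀
      G[-1]≡-H[m+1] : ∀ a b c m → - (a * (m + 1ℤ) * (m + 1ℤ) + - b * (m + 1ℤ) * 1ℤ + c * 1ℤ * 1ℤ)
        ≡ - (a * - m * - m + b * - m * 1ℤ + c * 1ℤ * 1ℤ) - - (b + (+ 2) * a * - m) + - a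
      G[-1]≡-H[m+1] = solve-∀
      c≡F[-m]-am²+bm : ∀ a b c m → - - (a * - m * - m + b * - m * 1ℤ + c * 1ℤ * 1ℤ) - a * m * m + b * m ≡ c
      c≡F[-m]-am²+bm = solve-∀
      b²≡Δ+4ac : ∀ a b c → b * b - (+ 4) * a * c + (+ 4) * a * c ≡ b * b
      b²≡Δ+4ac = solve-∀
      p∣b : + p ∣ b
      p∣b = prime∣square⇒prime∣ᵢ b p-prime (subst (+ p ∣_) (b²≡Δ+4ac a b c)
        (∣m∣n⇒∣m+n (subst (+ p ∣_) (sym disc≡Δ) p∣Δ) (∣m⇒∣m*n c (∣n⇒∣m*n (+ 4) p∣a))))
      invert-at : SignChangeFrom (λ x → ⟨ a , - b , c ⟩ ⟦ x , 1ℤ ⟧) 0ℤ → Representative (λ G → ReducedForm G × ¬ (+ p ∣ fa G)) F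
      invert-at (m , H[m]<0 , H[m+1]>0 , inj₁ refl) = ⊥-elim (<-asym a-b+c<0 (subst (0ℤ <_) (H[1]≡a-b+c a b c) H[m+1]>0))
      invert-at (m , H[m]<0 , H[m+1]>0 , inj₂ H[m-1]<0) =
        G , ∼-trans (∼-translate (- m) F) (∼-trans (∼-swap _) (∼-negate _)) ,
        (neg-mono-< (subst (_< 0ℤ) (sym (F[-m]≡H[m] a b c m)) H[m]<0) , neg-mono-< a>0 ,
         subst (0ℤ <_) (G[1]≡-H[m-1] a b c m) (neg-mono-< H[m-1]<0) ,
         subst (_< 0ℤ) (G[-1]≡-H[m+1] a b c m) (neg-mono-< H[m+1]>0)) ,
        p∤aG
        where
          G = negate (swap (translate (- m) F))
          p∤aG : ¬ (+ p ∣ fa G)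
          p∤aG p∣aG = ¬prime[1] (subst Prime (ℕ.∣1⇒≡1 (∣⇒∣ᵤ (F-primitive (p∣a , p∣b , p∣c)))) p-prime)
            where
              p∣c : + p ∣ c
              p∣c = subst (+ p ∣_) (c≡F[-m]-am²+bm a b c m)
                (∣m∣n⇒∣m+n (∣m∣n⇒∣m-n (∣m⇒∣-m p∣aG) (∣m⇒∣m*n m (∣m⇒∣m*n m p∣a))) (∣m⇒∣m*n m p∣b))

  reduced-representative : ∀ F → fdisc F ≡ Δ → fa F ≢ 0ℤ → Representative ReducedForm F
  reduced-representative F disc≡Δ a≢0 = reduce (descend (suc ∣ fa F ∣) F disc≡Δ a≢0 ℕ.≤-refl)
    where
      reduce : Representative Prereduced F → Representative ReducedForm F
      reduce (G , F∼G , G-prereduced) = ∼-representative F∼G (prereduced⇒reduced G (trans (∼-fdisc F∼G) disc≡Δ) G-prereduced)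

  reduced-representative-avoiding : ∀ {p} → Prime p → + p ∣ Δ → ∀ F → fdisc F ≡ Δ → Primitive F → fa F ≢ 0ℤ
    → Representative (λ G → ReducedForm G × ¬ (+ p ∣ fa G)) F
  reduced-representative-avoiding {p} p-prime p∣Δ F disc≡Δ F-primitive a≢0 = avoid (reduced-representative F disc≡Δ a≢0)
    where
      avoid-if : ∀ G → F ∼ G → ReducedForm G → Dec (+ p ∣ fa G) → Representative (λ G → ReducedForm G × ¬ (+ p ∣ fa G)) F
      avoid-if G F∼G G-reduced (no p∤aG) = G , F∼G , G-reduced , p∤aG
      avoid-if G F∼G G-reduced (yes p∣aG) = ∼-representative F∼G
        (avoid-prime-leading p-prime p∣Δ G (trans (∼-fdisc F∼G) disc≡Δ) (∼-primitive F∼G F-primitive) G-reduced p∣aG)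
      avoid : Representative ReducedForm F → Representative (λ G → ReducedForm G × ¬ (+ p ∣ fa G)) F
      avoid (G , F∼G , G-reduced) = avoid-if G F∼G G-reduced (+ p ∣? fa G)

∤⇒gcd≡1 : ∀ {p} i → Prime p → ¬ (+ p ∣ i) → gcd i (+ p) ≡ 1ℤ
∤⇒gcd≡1 {p} i p-prime p∤i with prime⇒irreducible p-prime (ℕ.gcd[m,n]∣n ∣ i ∣ p)
... | inj₁ gcd≡1 = cong +_ gcd≡1
... | inj₂ gcd≡p = ⊥-elim (p∤i (∣ᵤ⇒∣ (subst (ℕ._∣ ∣ i ∣) gcd≡p (ℕ.gcd[m,n]∣m ∣ i ∣ p))))

representative⇒reduced-irrational : ∀ {Δ p} (ξ : QI Δ) → Prime p
  → Representative (λ G → ReducedForm G × ¬ (+ p ∣ fa G)) (formOf ξ)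
  → ∃[ η ] (Equiv Δ ξ η × Reduced Δ η × 0ℤ < a η × gcd (a η) (+ p) ≡ 1ℤ)
representative⇒reduced-irrational ξ p-prime (G , ξ∼G , G-reduced@(a>0 , _) , p∤a) =
  η , ∼⇒Equiv ξ η ξ∼G , reducedForm⇒Reduced η G-reduced , a>0 , ∤⇒gcd≡1 (fa G) p-prime p∤a
  where
    η = qi (fa G) (fb G) (fc G) (λ a≡0 → <⇒≢ a>0 (sym a≡0))
           (primitive⇒gcd≡1 (∼-primitive ξ∼G (gcd≡1⇒primitive (prim ξ)))) (trans (∼-fdisc ξ∼G) (disc ξ))

lemma4p1 : (p₁ p₂ f : ℕ) → Prime p₁ → Prime p₂ → p₁ ≢ p₂
    → p₁ % 4 ≡ 3 → p₂ % 4 ≡ 3 → (f ≡ 1 ⊎ f ≡ 2)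
    → (Δ : ℤ) → Δ ≡ + (p₁ Data.Nat.* p₂ Data.Nat.* (f Data.Nat.* f))
    → (ξ : QI Δ) → ∃[ η ] (Equiv Δ ξ η × Reduced Δ η × 0ℤ < a η × gcd (a η) (+ p₁) ≡ 1ℤ)
lemma4p1 p₁ p₂ f p₁-prime p₂-prime p₁≢p₂ p₁≡3 _ f∈12 Δ refl ξ =
  representative⇒reduced-irrational ξ p₁-prime
    (reduced-representative-avoiding (nonsquare⇒nonsquareℤ nonsquare) (nonsquare⇒pos nonsquare)
      p₁-prime p₁∣Δ (formOf ξ) (disc ξ) (gcd≡1⇒primitive (prim ξ)) (a≢0 ξ))
  where
    nonsquare = p₁p₂f²-nonsquare p₁-prime p₂-prime p₁≢p₂ p₁≡3 f∈12
    p₁∣Δ : + p₁ ∣ Δ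
    p₁∣Δ = ∣ᵤ⇒∣ (ℕ.∣m⇒∣m*n (f ℕ.* f) (ℕ.∣m⇒∣m*n p₂ ℕ.∣-refl))
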